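{- Let $\alpha\in\mathbb Z\setminus\{0,1\}$ and let $(h_n)$ be the sequence with $h_0=0$, $h_1=1$, $h_2=-\alpha^2(\alpha-1)$, $h_3=-\alpha^6(\alpha-1)^3$, $h_4=\alpha^{11}(\alpha-1)^6$, and for $m\ge2$: $h_{2m+1}=h_{m+2}h_m^3-h_{m-1}h_{m+1}^3$, for $m\ge 3$: $h_{2m}=h_m\big(h_{m+2}h_{m-1}^2-h_{m-2}h_{m+1}^2\big)/h_2$. (i) If $n\equiv 6,8\pmod{14}$, then $h_n$ is not a square. (ii) If $n\equiv 2,5,16,19\pmod{21}$, then $h_n$ is not a cube.
   Context: The sequence defined is the elliptic divisibility sequence attached to the point $(0,0)$ of order $7$ on the Tate normal form curve with $b=\alpha^3-\alpha^2$, $c=\alpha^2-\alpha$. Convention: an integer $m$ is called a square if $m=\pm\beta^2$ for some nonzero integer $\beta$, and a cube if $m=\beta^3$ for some nonzero integer $\beta$. -}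

module Defs where

open import Data.Nat as ℕ using (ℕ; zero; suc; _∸_)
open import Data.Integer as ℤ using (ℤ; +_; -_; _+_; _-_; _*_; _^_; _/_)
open import Data.Product using (∃; _×_)
open import Data.Sum using (_⊎_)
open import Relation.Binary.PropositionalEquality using (_≡_)
open import Relation.Nullary using (¬_)

-- Integer division that returns 0 when the divisor is 0.
-- (In the sequence below the divisor is h₂ = -α²(α-1) ≠ 0 for α ∉ {0,1},
--  and the division is exact, so this is ordinary exact division.)
_÷_ : ℤ → ℤ → ℤ
a ÷ (+ zero)       = + 0
a ÷ b@(+ suc _)    = a / b
a ÷ b@(ℤ.-[1+ _ ]) = a / b

-- The elliptic divisibility sequence (h_n) attached to α.
-- hF is the recursion with an explicit fuel argument (only to make
-- termination structural); every recursive call has strictly smaller index,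
-- so fuel n+1 suffices and  h α n  is exactly the sequence of the paper.
hF : ℤ → ℕ → ℕ → ℤ
hF α zero    n = + 0
hF α (suc f) 0 = + 0
hF α (suc f) 1 = + 1
hF α (suc f) 2 = - (α ^ 2 * (α - + 1))
hF α (suc f) 3 = - (α ^ 6 * (α - + 1) ^ 3)
hF α (suc f) 4 = α ^ 11 * (α - + 1) ^ 6
hF α (suc f) n@(suc (suc (suc (suc (suc _))))) = step (n ℕ.% 2)
  where
  r : ℕ → ℤ
  r = hF α f
  m : ℕ
  m = n ℕ./ 2
  step : ℕ → ℤ
  -- n = 2m+1 with m ≥ 2
  step (suc _) = r (m ℕ.+ 2) * r m ^ 3 - r (m ∸ 1) * r (m ℕ.+ 1) ^ 3
  -- n = 2m with m ≥ 3
  step zero    = (r m * (r (m ℕ.+ 2) * r (m ∸ 1) ^ 2 - r (m ∸ 2) * r (m ℕ.+ 1) ^ 2)) ÷ r 2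

h : ℤ → ℕ → ℤ
h α n = hF α (suc n) n

IsSquare : ℤ → Set
IsSquare x = ∃ λ (β : ℤ) → ¬ (β ≡ + 0) × (x ≡ β * β ⊎ x ≡ - (β * β))

IsCube : ℤ → Set
IsCube x = ∃ λ (β : ℤ) → ¬ (β ≡ + 0) × x ≡ β * β * β

-- Since (0,0) has order 7, h_n has an explicit closed form: with β = α - 1,
--   h_n = sign(n mod 7) · α^⌊5n²/7⌋ · β^⌊3n²/7⌋,
-- where the sign is 0, +, -, -, +, +, - on the residues 0, …, 6.  Writing n = j + 7q,
-- the closed form is quasi-periodic:  h_{j+7q} = γ^τ(q,j) · h_j  with γ = α⁵β³ and
-- τ(q,j) = q(2j + 7q).  Both recurrences are homogeneous, and the weights τ balance,
-- so each recurrence reduces to its instance at the seven smallest indices; there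
-- the two monomials either coincide, vanish, or differ by one factor α, and
-- α - β = 1 finishes.  Strong induction then identifies h with the closed form.
-- Finally, on the residue classes of the theorem the exponents are odd (resp.
-- ≡ 2, 1 mod 3); dividing out the largest square (cube) leaves |α(α-1)| (resp.
-- |α²(α-1)|), which lies strictly between two consecutive squares (cubes).
module Submission where

open import Defs
open import Data.Nat using (ℕ; zero; suc; _%_; _/_; _+_; _*_; _^_; _∸_; _≤_; _<_; z≤n; s≤s; NonZero; ≢-nonZero)
open import Data.Integer using (ℤ; +_; -[1+_]; +[1+_]; ∣_∣; 1ℤ; -1ℤ)
  renaming (_*_ to _*ᶻ_; _-_ to _-ᶻ_; _^_ to _^ᶻ_; -_ to -ᶻ_)
import Data.Nat.Properties as ℕ
import Data.Integer.Properties as ℤ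
import Data.Nat.DivMod as ℕ
import Data.Integer.DivMod as ℤ
import Data.Integer.Base as ℤ
open import Data.Nat.Divisibility using (_∣_; divides; ∣-trans; m∣m*n; *-cancelʳ-∣; ∣1⇒≡1; quotient)
open import Data.Nat.GCD using (gcd; gcd[m,n]∣m; gcd[m,n]∣n; gcd[m,n]≢0)
open import Data.Nat.Coprimality using (Coprime; coprime-divisor; coprime-/gcd)
open import Data.Product using (_×_; _,_; proj₁; proj₂; ∃-syntax; uncurry)
open import Data.Sum using (_⊎_; inj₁; inj₂)
open import Relation.Binary.PropositionalEquality
open import Relation.Nullary using (¬_; yes; no)
open import Data.Empty using (⊥-elim)
open import Function using (_∘_)
open import Data.Nat.Tactic.RingSolver using (solve-∀)
import Data.Integer.Tactic.RingSolver as ℤ-Solver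

^ᶻ-distribʳ-* : ∀ (x y : ℤ) n → (x *ᶻ y) ^ᶻ n ≡ x ^ᶻ n *ᶻ y ^ᶻ n
^ᶻ-distribʳ-* x y zero    = refl
^ᶻ-distribʳ-* x y (suc n) = begin
  x *ᶻ y *ᶻ (x *ᶻ y) ^ᶻ n           ≡⟨ cong (x *ᶻ y *ᶻ_) (^ᶻ-distribʳ-* x y n) ⟩
  x *ᶻ y *ᶻ (x ^ᶻ n *ᶻ y ^ᶻ n)      ≡⟨ swap x y (x ^ᶻ n) (y ^ᶻ n) ⟩
  x *ᶻ x ^ᶻ n *ᶻ (y *ᶻ y ^ᶻ n)      ∎
  where
  open ≡-Reasoning
  swap : ∀ a b c d → a *ᶻ b *ᶻ (c *ᶻ d) ≡ a *ᶻ c *ᶻ (b *ᶻ d)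
  swap = ℤ-Solver.solve-∀

abs-^ : ∀ x n → ∣ x ^ᶻ n ∣ ≡ ∣ x ∣ ^ n
abs-^ x zero    = refl
abs-^ x (suc n) = trans (ℤ.abs-* x (x ^ᶻ n)) (cong (∣ x ∣ *_) (abs-^ x n))

-- Ring identities separating the scaling factors from the terms of the recurrences.
-- (The solver does not see through  _^_  on ℤ, so the powers are stated unfolded;
--  x ^ 3  is definitionally  x * (x * (x * 1)).)
regroup-odd : ∀ C₁ C₂ C₃ C₄ x₁ x₂ x₃ x₄ →
  C₁ *ᶻ x₁ *ᶻ (C₂ *ᶻ x₂) ^ᶻ 3 -ᶻ C₃ *ᶻ x₃ *ᶻ (C₄ *ᶻ x₄) ^ᶻ 3
    ≡ C₁ *ᶻ C₂ ^ᶻ 3 *ᶻ (x₁ *ᶻ x₂ ^ᶻ 3) -ᶻ C₃ *ᶻ C₄ ^ᶻ 3 *ᶻ (x₃ *ᶻ x₄ ^ᶻ 3)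
regroup-odd = unfolded
  where
  unfolded : ∀ C₁ C₂ C₃ C₄ x₁ x₂ x₃ x₄ →
    C₁ *ᶻ x₁ *ᶻ (C₂ *ᶻ x₂ *ᶻ (C₂ *ᶻ x₂ *ᶻ (C₂ *ᶻ x₂ *ᶻ 1ℤ)))
      -ᶻ C₃ *ᶻ x₃ *ᶻ (C₄ *ᶻ x₄ *ᶻ (C₄ *ᶻ x₄ *ᶻ (C₄ *ᶻ x₄ *ᶻ 1ℤ)))
      ≡ C₁ *ᶻ (C₂ *ᶻ (C₂ *ᶻ (C₂ *ᶻ 1ℤ))) *ᶻ (x₁ *ᶻ (x₂ *ᶻ (x₂ *ᶻ (x₂ *ᶻ 1ℤ))))
        -ᶻ C₃ *ᶻ (C₄ *ᶻ (C₄ *ᶻ (C₄ *ᶻ 1ℤ))) *ᶻ (x₃ *ᶻ (x₄ *ᶻ (x₄ *ᶻ (x₄ *ᶻ 1ℤ))))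
  unfolded = ℤ-Solver.solve-∀

regroup-even : ∀ C₁ C₂ C₃ C₄ C₅ x₁ x₂ x₃ x₄ x₅ →
  C₁ *ᶻ x₁ *ᶻ (C₂ *ᶻ x₂ *ᶻ (C₃ *ᶻ x₃) ^ᶻ 2 -ᶻ C₄ *ᶻ x₄ *ᶻ (C₅ *ᶻ x₅) ^ᶻ 2)
    ≡ C₁ *ᶻ (C₂ *ᶻ C₃ ^ᶻ 2) *ᶻ (x₁ *ᶻ (x₂ *ᶻ x₃ ^ᶻ 2))
      -ᶻ C₁ *ᶻ (C₄ *ᶻ C₅ ^ᶻ 2) *ᶻ (x₁ *ᶻ (x₄ *ᶻ x₅ ^ᶻ 2))
regroup-even = unfolded
  where
  unfolded : ∀ C₁ C₂ C₃ C₄ C₅ x₁ x₂ x₃ x₄ x₅ →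
    C₁ *ᶻ x₁ *ᶻ (C₂ *ᶻ x₂ *ᶻ (C₃ *ᶻ x₃ *ᶻ (C₃ *ᶻ x₃ *ᶻ 1ℤ))
                 -ᶻ C₄ *ᶻ x₄ *ᶻ (C₅ *ᶻ x₅ *ᶻ (C₅ *ᶻ x₅ *ᶻ 1ℤ)))
      ≡ C₁ *ᶻ (C₂ *ᶻ (C₃ *ᶻ (C₃ *ᶻ 1ℤ))) *ᶻ (x₁ *ᶻ (x₂ *ᶻ (x₃ *ᶻ (x₃ *ᶻ 1ℤ))))
        -ᶻ C₁ *ᶻ (C₄ *ᶻ (C₅ *ᶻ (C₅ *ᶻ 1ℤ))) *ᶻ (x₁ *ᶻ (x₄ *ᶻ (x₅ *ᶻ (x₅ *ᶻ 1ℤ))))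
  unfolded = ℤ-Solver.solve-∀

factor-odd : ∀ C u v → C *ᶻ u -ᶻ C *ᶻ v ≡ C *ᶻ (u -ᶻ v)
factor-odd = ℤ-Solver.solve-∀

factor-even : ∀ C x u v → C *ᶻ (x *ᶻ u) -ᶻ C *ᶻ (x *ᶻ v) ≡ C *ᶻ (x *ᶻ (u -ᶻ v))
factor-even = ℤ-Solver.solve-∀

module Homogeneity (c : ℤ) where
  open ≡-Reasoning

  pow-combine : ∀ a b k n → a + b * k ≡ n → c ^ᶻ a *ᶻ (c ^ᶻ b) ^ᶻ k ≡ c ^ᶻ n
  pow-combine a b k n refl = begin
    c ^ᶻ a *ᶻ (c ^ᶻ b) ^ᶻ k    ≡⟨ cong (c ^ᶻ a *ᶻ_) (ℤ.^-*-assoc c b k) ⟩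
    c ^ᶻ a *ᶻ c ^ᶻ (b * k)     ≡⟨ sym (ℤ.^-distribˡ-+-* c a (b * k)) ⟩
    c ^ᶻ (a + b * k)           ∎

  odd-homogeneous : ∀ (t₁ t₂ t₃ t₄ t₅ : ℕ) (x₁ x₂ x₃ x₄ x₅ : ℤ) {y₁ y₂ y₃ y₄ y₅ : ℤ} →
    t₁ + t₂ * 3 ≡ t₅ → t₃ + t₄ * 3 ≡ t₅ →
    y₁ ≡ c ^ᶻ t₁ *ᶻ x₁ → y₂ ≡ c ^ᶻ t₂ *ᶻ x₂ → y₃ ≡ c ^ᶻ t₃ *ᶻ x₃ → y₄ ≡ c ^ᶻ t₄ *ᶻ x₄ →
    y₅ ≡ c ^ᶻ t₅ *ᶻ x₅ →
    x₁ *ᶻ x₂ ^ᶻ 3 -ᶻ x₃ *ᶻ x₄ ^ᶻ 3 ≡ x₅ →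
    y₁ *ᶻ y₂ ^ᶻ 3 -ᶻ y₃ *ᶻ y₄ ^ᶻ 3 ≡ y₅
  odd-homogeneous t₁ t₂ t₃ t₄ t₅ x₁ x₂ x₃ x₄ x₅ w₁ w₂ refl refl refl refl refl rel = begin
    c ^ᶻ t₁ *ᶻ x₁ *ᶻ (c ^ᶻ t₂ *ᶻ x₂) ^ᶻ 3 -ᶻ c ^ᶻ t₃ *ᶻ x₃ *ᶻ (c ^ᶻ t₄ *ᶻ x₄) ^ᶻ 3
      ≡⟨ regroup-odd (c ^ᶻ t₁) (c ^ᶻ t₂) (c ^ᶻ t₃) (c ^ᶻ t₄) x₁ x₂ x₃ x₄ ⟩
    c ^ᶻ t₁ *ᶻ (c ^ᶻ t₂) ^ᶻ 3 *ᶻ (x₁ *ᶻ x₂ ^ᶻ 3) -ᶻ c ^ᶻ t₃ *ᶻ (c ^ᶻ t₄) ^ᶻ 3 *ᶻ (x₃ *ᶻ x₄ ^ᶻ 3)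
      ≡⟨ cong₂ (λ p q → p *ᶻ (x₁ *ᶻ x₂ ^ᶻ 3) -ᶻ q *ᶻ (x₃ *ᶻ x₄ ^ᶻ 3))
               (pow-combine t₁ t₂ 3 t₅ w₁) (pow-combine t₃ t₄ 3 t₅ w₂) ⟩
    c ^ᶻ t₅ *ᶻ (x₁ *ᶻ x₂ ^ᶻ 3) -ᶻ c ^ᶻ t₅ *ᶻ (x₃ *ᶻ x₄ ^ᶻ 3)
      ≡⟨ factor-odd (c ^ᶻ t₅) (x₁ *ᶻ x₂ ^ᶻ 3) (x₃ *ᶻ x₄ ^ᶻ 3) ⟩
    c ^ᶻ t₅ *ᶻ (x₁ *ᶻ x₂ ^ᶻ 3 -ᶻ x₃ *ᶻ x₄ ^ᶻ 3)
      ≡⟨ cong (c ^ᶻ t₅ *ᶻ_) rel ⟩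
    c ^ᶻ t₅ *ᶻ x₅ ∎

  even-homogeneous : ∀ (t₁ t₂ t₃ t₄ t₅ t₆ : ℕ) (x₁ x₂ x₃ x₄ x₅ x₆ z : ℤ) {y₁ y₂ y₃ y₄ y₅ y₆ : ℤ} →
    t₁ + (t₂ + t₃ * 2) ≡ t₆ → t₁ + (t₄ + t₅ * 2) ≡ t₆ →
    y₁ ≡ c ^ᶻ t₁ *ᶻ x₁ → y₂ ≡ c ^ᶻ t₂ *ᶻ x₂ → y₃ ≡ c ^ᶻ t₃ *ᶻ x₃ → y₄ ≡ c ^ᶻ t₄ *ᶻ x₄ →
    y₅ ≡ c ^ᶻ t₅ *ᶻ x₅ → y₆ ≡ c ^ᶻ t₆ *ᶻ x₆ →
    x₁ *ᶻ (x₂ *ᶻ x₃ ^ᶻ 2 -ᶻ x₄ *ᶻ x₅ ^ᶻ 2) ≡ x₆ *ᶻ z →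
    y₁ *ᶻ (y₂ *ᶻ y₃ ^ᶻ 2 -ᶻ y₄ *ᶻ y₅ ^ᶻ 2) ≡ y₆ *ᶻ z
  even-homogeneous t₁ t₂ t₃ t₄ t₅ t₆ x₁ x₂ x₃ x₄ x₅ x₆ z w₁ w₂ refl refl refl refl refl refl rel = begin
    c ^ᶻ t₁ *ᶻ x₁ *ᶻ (c ^ᶻ t₂ *ᶻ x₂ *ᶻ (c ^ᶻ t₃ *ᶻ x₃) ^ᶻ 2
                      -ᶻ c ^ᶻ t₄ *ᶻ x₄ *ᶻ (c ^ᶻ t₅ *ᶻ x₅) ^ᶻ 2)
      ≡⟨ regroup-even (c ^ᶻ t₁) (c ^ᶻ t₂) (c ^ᶻ t₃) (c ^ᶻ t₄) (c ^ᶻ t₅) x₁ x₂ x₃ x₄ x₅ ⟩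
    c ^ᶻ t₁ *ᶻ (c ^ᶻ t₂ *ᶻ (c ^ᶻ t₃) ^ᶻ 2) *ᶻ (x₁ *ᶻ (x₂ *ᶻ x₃ ^ᶻ 2))
      -ᶻ c ^ᶻ t₁ *ᶻ (c ^ᶻ t₄ *ᶻ (c ^ᶻ t₅) ^ᶻ 2) *ᶻ (x₁ *ᶻ (x₄ *ᶻ x₅ ^ᶻ 2))
      ≡⟨ cong₂ (λ p q → c ^ᶻ t₁ *ᶻ p *ᶻ (x₁ *ᶻ (x₂ *ᶻ x₃ ^ᶻ 2))
                         -ᶻ c ^ᶻ t₁ *ᶻ q *ᶻ (x₁ *ᶻ (x₄ *ᶻ x₅ ^ᶻ 2)))
               (pow-combine t₂ t₃ 2 _ refl) (pow-combine t₄ t₅ 2 _ refl) ⟩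
    c ^ᶻ t₁ *ᶻ c ^ᶻ (t₂ + t₃ * 2) *ᶻ (x₁ *ᶻ (x₂ *ᶻ x₃ ^ᶻ 2))
      -ᶻ c ^ᶻ t₁ *ᶻ c ^ᶻ (t₄ + t₅ * 2) *ᶻ (x₁ *ᶻ (x₄ *ᶻ x₅ ^ᶻ 2))
      ≡⟨ cong₂ (λ p q → p *ᶻ (x₁ *ᶻ (x₂ *ᶻ x₃ ^ᶻ 2)) -ᶻ q *ᶻ (x₁ *ᶻ (x₄ *ᶻ x₅ ^ᶻ 2)))
               (trans (sym (ℤ.^-distribˡ-+-* c t₁ _)) (cong (c ^ᶻ_) w₁))
               (trans (sym (ℤ.^-distribˡ-+-* c t₁ _)) (cong (c ^ᶻ_) w₂)) ⟩
    c ^ᶻ t₆ *ᶻ (x₁ *ᶻ (x₂ *ᶻ x₃ ^ᶻ 2)) -ᶻ c ^ᶻ t₆ *ᶻ (x₁ *ᶻ (x₄ *ᶻ x₅ ^ᶻ 2))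
      ≡⟨ factor-even (c ^ᶻ t₆) x₁ (x₂ *ᶻ x₃ ^ᶻ 2) (x₄ *ᶻ x₅ ^ᶻ 2) ⟩
    c ^ᶻ t₆ *ᶻ (x₁ *ᶻ (x₂ *ᶻ x₃ ^ᶻ 2 -ᶻ x₄ *ᶻ x₅ ^ᶻ 2))
      ≡⟨ cong (c ^ᶻ t₆ *ᶻ_) rel ⟩
    c ^ᶻ t₆ *ᶻ (x₆ *ᶻ z)
      ≡⟨ ℤ.*-assoc (c ^ᶻ t₆) x₆ z ⟨
    c ^ᶻ t₆ *ᶻ x₆ *ᶻ z ∎

^-distribʳ-* : ∀ x y p → (x * y) ^ p ≡ x ^ p * y ^ p
^-distribʳ-* x y zero    = refl
^-distribʳ-* x y (suc p) = begin
  x * y * (x * y) ^ p         ≡⟨ cong (x * y *_) (^-distribʳ-* x y p) ⟩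
  x * y * (x ^ p * y ^ p)     ≡⟨ swap x y (x ^ p) (y ^ p) ⟩
  x * x ^ p * (y * y ^ p)     ∎
  where
  open ≡-Reasoning
  swap : ∀ a b c d → a * b * (c * d) ≡ a * c * (b * d)
  swap = solve-∀

coprime-∣-^ : ∀ {a c} p → Coprime a c → a ∣ c ^ p → a ≡ 1
coprime-∣-^ zero    _   a∣1    = ∣1⇒≡1 a∣1
coprime-∣-^ (suc p) cop a∣c^p+1 = coprime-∣-^ p cop (coprime-divisor cop a∣c^p+1)

-- Divisibility of p-th powers (p ≥ 1) descends to the bases: cancel the gcd d,
-- and the coprime cofactor A/d, dividing (c/d)^p, must be 1.
^-cancel-∣ : ∀ p .{{_ : NonZero p}} {A c} → ¬ A ≡ 0 → A ^ p ∣ c ^ p → A ∣ c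
^-cancel-∣ p@(suc p′) {A} {c} A≢0 A^p∣c^p = subst (_∣ c) (sym A≡d) (gcd[m,n]∣n A c)
  where
  d = gcd A c
  instance
    d≢0 : NonZero d
    d≢0 = ≢-nonZero (gcd[m,n]≢0 A c (inj₁ A≢0))
  a′ = A ℕ./ d
  c′ = c ℕ./ d
  A≡ : A ≡ a′ * d
  A≡ = sym (ℕ.m/n*n≡m (gcd[m,n]∣m A c))
  c≡ : c ≡ c′ * d
  c≡ = sym (ℕ.m/n*n≡m (gcd[m,n]∣n A c))
  instance
    d^p≢0 : NonZero (d ^ p)
    d^p≢0 = ℕ.m^n≢0 d p
  a′^p∣c′^p : a′ ^ p ∣ c′ ^ p
  a′^p∣c′^p = *-cancelʳ-∣ (d ^ p) (subst₂ _∣_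
    (trans (cong (_^ p) A≡) (^-distribʳ-* a′ d p)) (trans (cong (_^ p) c≡) (^-distribʳ-* c′ d p)) A^p∣c^p)
  a′≡1 : a′ ≡ 1
  a′≡1 = coprime-∣-^ p (coprime-/gcd A c) (∣-trans (m∣m*n (a′ ^ p′)) a′^p∣c′^p)
  A≡d : A ≡ d
  A≡d = trans A≡ (trans (cong (_* d) a′≡1) (ℕ.*-identityˡ d))

power-cofactor : ∀ p .{{_ : NonZero p}} {A x c} → ¬ A ≡ 0 → A ^ p * x ≡ c ^ p → ∃[ δ ] x ≡ δ ^ p
power-cofactor p {A} {x} {c} A≢0 eq = δ , ℕ.*-cancelˡ-≡ x (δ ^ p) (A ^ p) {{ℕ.m^n≢0 A p {{≢-nonZero A≢0}}}} (begin
  A ^ p * x          ≡⟨ eq ⟩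
  c ^ p              ≡⟨ cong (_^ p) c≡δA ⟩
  (δ * A) ^ p        ≡⟨ ^-distribʳ-* δ A p ⟩
  δ ^ p * A ^ p      ≡⟨ ℕ.*-comm (δ ^ p) (A ^ p) ⟩
  A ^ p * δ ^ p      ∎)
  where
  open ≡-Reasoning
  A∣c : A ∣ c
  A∣c = ^-cancel-∣ p A≢0 (divides x (trans (sym eq) (ℕ.*-comm (A ^ p) x)))
  δ = quotient A∣c
  c≡δA : c ≡ δ * A
  c≡δA = _∣_.equality A∣c

power-cofactor₂ : ∀ p .{{_ : NonZero p}} u v r s a b c → ¬ u ≡ 0 → ¬ v ≡ 0 →
  u ^ (r + a * p) * v ^ (s + b * p) ≡ c ^ p → ∃[ δ ] u ^ r * v ^ s ≡ δ ^ p
power-cofactor₂ p u v r s a b c u≢0 v≢0 eq = power-cofactor p {u ^ a * v ^ b} {u ^ r * v ^ s} {c} A≢0 (trans split eq)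
  where
  open ≡-Reasoning
  A≢0 : ¬ u ^ a * v ^ b ≡ 0
  A≢0 uv≡0 with ℕ.m*n≡0⇒m≡0∨n≡0 (u ^ a) uv≡0
  ... | inj₁ p≡0 = u≢0 (ℕ.m^n≡0⇒m≡0 u a p≡0)
  ... | inj₂ p≡0 = v≢0 (ℕ.m^n≡0⇒m≡0 v b p≡0)
  split : (u ^ a * v ^ b) ^ p * (u ^ r * v ^ s) ≡ u ^ (r + a * p) * v ^ (s + b * p)
  split = begin
    (u ^ a * v ^ b) ^ p * (u ^ r * v ^ s)      ≡⟨ cong (_* (u ^ r * v ^ s)) (^-distribʳ-* (u ^ a) (v ^ b) p) ⟩
    (u ^ a) ^ p * (v ^ b) ^ p * (u ^ r * v ^ s) ≡⟨ cong₂ (λ x y → x * y * (u ^ r * v ^ s)) (ℕ.^-*-assoc u a p) (ℕ.^-*-assoc v b p) ⟩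
    u ^ (a * p) * v ^ (b * p) * (u ^ r * v ^ s) ≡⟨ regroup (u ^ (a * p)) (v ^ (b * p)) (u ^ r) (v ^ s) ⟩
    u ^ r * u ^ (a * p) * (v ^ s * v ^ (b * p)) ≡⟨ cong₂ _*_ (ℕ.^-distribˡ-+-* u r (a * p)) (ℕ.^-distribˡ-+-* v s (b * p)) ⟨
    u ^ (r + a * p) * v ^ (s + b * p)           ∎
    where
    regroup : ∀ X Y Z W → X * Y * (Z * W) ≡ Z * X * (W * Y)
    regroup = solve-∀

no-power-between : ∀ p k n → k ^ p < n → n < suc k ^ p → ∀ δ → ¬ n ≡ δ ^ p
no-power-between p k n lower upper δ refl with δ ℕ.≤? k
... | yes δ≤k = ℕ.<⇒≱ lower (ℕ.^-monoˡ-≤ p δ≤k)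
... | no  δ≰k = ℕ.<⇒≱ upper (ℕ.^-monoˡ-≤ p (ℕ.≰⇒> δ≰k))

-- x^a (x+1)^b lies strictly between x^(a+b) and (x+1)^(a+b), so is no (a+b)-th power.
mixed-not-power : ∀ x a b .{{_ : NonZero x}} .{{_ : NonZero a}} .{{_ : NonZero b}} →
  ∀ δ → ¬ x ^ a * suc x ^ b ≡ δ ^ (a + b)
mixed-not-power x a b = no-power-between (a + b) x (x ^ a * suc x ^ b) lower upper
  where
  open ℕ.≤-Reasoning
  lower : x ^ (a + b) < x ^ a * suc x ^ b
  lower = begin-strict
    x ^ (a + b)          ≡⟨ ℕ.^-distribˡ-+-* x a b ⟩
    x ^ a * x ^ b        <⟨ ℕ.*-monoʳ-< (x ^ a) {{ℕ.m^n≢0 x a}} (ℕ.^-monoˡ-< b ℕ.≤-refl) ⟩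
    x ^ a * suc x ^ b    ∎
  upper : x ^ a * suc x ^ b < suc x ^ (a + b)
  upper = begin-strict
    x ^ a * suc x ^ b      <⟨ ℕ.*-monoˡ-< (suc x ^ b) {{ℕ.m^n≢0 (suc x) b}} (ℕ.^-monoˡ-< a ℕ.≤-refl) ⟩
    suc x ^ a * suc x ^ b  ≡⟨ ℕ.^-distribˡ-+-* (suc x) a b ⟨
    suc x ^ (a + b)        ∎

consecutive : ∀ α → ¬ α ≡ + 0 → ¬ α ≡ + 1 →
  ∃[ x ] NonZero x × ((∣ α ∣ ≡ x × ∣ α -ᶻ + 1 ∣ ≡ suc x) ⊎ (∣ α ∣ ≡ suc x × ∣ α -ᶻ + 1 ∣ ≡ x))
consecutive (+ zero)        α≢0 _   = ⊥-elim (α≢0 refl)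
consecutive +[1+ zero ]     _   α≢1 = ⊥-elim (α≢1 refl)
consecutive +[1+ suc x ]    _   _   = suc x , _ , inj₂ (refl , refl)
consecutive -[1+ x ]        _   _   = suc x , _ , inj₁ (refl , cong (suc ∘ suc) (ℕ.+-identityʳ x))

-- Exact division: (q·b) / b = q.  The remainder r satisfies (q - q')·b = r < |b|,
-- which forces q' = q.
m*n<n⇒m≡0 : ∀ m n → m * n < n → m ≡ 0
m*n<n⇒m≡0 zero    n _ = refl
m*n<n⇒m≡0 (suc m) n p = ⊥-elim (ℕ.<-irrefl refl (ℕ.<-≤-trans p (ℕ.m≤m+n n (m * n))))

/-exact : ∀ q b .{{_ : ℤ.NonZero b}} → (q *ᶻ b) ℤ./ b ≡ q
/-exact q b = sym (ℤ.i-j≡0⇒i≡j q q′ (ℤ.∣i∣≡0⇒i≡0 (m*n<n⇒m≡0 ∣ q -ᶻ q′ ∣ ∣ b ∣ small)))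
  where
  q′ = (q *ᶻ b) ℤ./ b
  r = (q *ᶻ b) ℤ.% b
  difference : (q -ᶻ q′) *ᶻ b ≡ + r
  difference = begin
    (q -ᶻ q′) *ᶻ b               ≡⟨ shuffle q q′ b ⟩
    q *ᶻ b -ᶻ q′ *ᶻ b            ≡⟨ cong (_-ᶻ q′ *ᶻ b) (ℤ.a≡a%n+[a/n]*n (q *ᶻ b) b) ⟩
    + r ℤ.+ q′ *ᶻ b -ᶻ q′ *ᶻ b   ≡⟨ cancel (+ r) (q′ *ᶻ b) ⟩
    + r                          ∎
    where
    open ≡-Reasoning
    shuffle : ∀ x y z → (x -ᶻ y) *ᶻ z ≡ x *ᶻ z -ᶻ y *ᶻ z
    shuffle = ℤ-Solver.solve-∀
    cancel : ∀ x y → x ℤ.+ y -ᶻ y ≡ x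
    cancel = ℤ-Solver.solve-∀
  small : ∣ q -ᶻ q′ ∣ * ∣ b ∣ < ∣ b ∣
  small = subst (_< ∣ b ∣) (trans (sym (cong ∣_∣ difference)) (ℤ.abs-* (q -ᶻ q′) b)) (ℤ.n%d<d (q *ᶻ b) b)

÷-exact : ∀ q b → ¬ b ≡ + 0 → (q *ᶻ b) ÷ b ≡ q
÷-exact q (+ zero)      b≢0 = ⊥-elim (b≢0 refl)
÷-exact q b@(+[1+ _ ])  _   = /-exact q b
÷-exact q b@(-[1+ _ ])  _   = /-exact q b

odd-step even-step : (ℕ → ℤ) → ℕ → ℤ
odd-step u m = u (m + 2) *ᶻ u m ^ᶻ 3 -ᶻ u (m ∸ 1) *ᶻ u (m + 1) ^ᶻ 3
even-step u m = u m *ᶻ (u (m + 2) *ᶻ u (m ∸ 1) ^ᶻ 2 -ᶻ u (m ∸ 2) *ᶻ u (m + 1) ^ᶻ 2)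

step-local : ∀ (u v : ℕ → ℤ) m → (∀ i → i ≤ m + 2 → u i ≡ v i) →
  odd-step u m ≡ odd-step v m × even-step u m ≡ even-step v m
step-local u v m agree =
  cong₂ _-ᶻ_ (cong₂ _*ᶻ_ at+2 (cong (_^ᶻ 3) at0)) (cong₂ _*ᶻ_ at-1 (cong (_^ᶻ 3) at+1)) ,
  cong₂ _*ᶻ_ at0 (cong₂ _-ᶻ_ (cong₂ _*ᶻ_ at+2 (cong (_^ᶻ 2) at-1)) (cong₂ _*ᶻ_ at-2 (cong (_^ᶻ 2) at+1)))
  where
  at0 : u m ≡ v m
  at0 = agree m (ℕ.m≤m+n m 2)
  at+1 : u (m + 1) ≡ v (m + 1)
  at+1 = agree (m + 1) (ℕ.+-monoʳ-≤ m (s≤s z≤n))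
  at+2 : u (m + 2) ≡ v (m + 2)
  at+2 = agree (m + 2) ℕ.≤-refl
  at-1 : u (m ∸ 1) ≡ v (m ∸ 1)
  at-1 = agree (m ∸ 1) (ℕ.≤-trans (ℕ.m∸n≤m m 1) (ℕ.m≤m+n m 2))
  at-2 : u (m ∸ 2) ≡ v (m ∸ 2)
  at-2 = agree (m ∸ 2) (ℕ.≤-trans (ℕ.m∸n≤m m 2) (ℕ.m≤m+n m 2))

sign : ℕ → ℤ
sign 1 = + 1
sign 2 = -1ℤ
sign 3 = -1ℤ
sign 4 = + 1
sign 5 = + 1
sign 6 = -1ℤ
sign _ = + 0

E F : ℕ → ℕ
E n = 5 * n * n / 7
F n = 3 * n * n / 7

-- τ(q, j) = ((j + 7q)² - j²)/7, the growth of n²/7 along the residue class of j.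
τ : ℕ → ℕ → ℕ
τ q j = q * (j + j + q * 7)

-- ⌊c(j+7q)²/7⌋ = ⌊cj²/7⌋ + c·τ(q,j), because c(j+7q)² = cj² + 7·c·τ(q,j).
quadratic-shift : ∀ c j q → c * (j + q * 7) * (j + q * 7) / 7 ≡ c * j * j / 7 + c * τ q j
quadratic-shift c j q = begin
  c * (j + q * 7) * (j + q * 7) / 7   ≡⟨ ℕ./-congˡ (expand c j q) ⟩
  (c * j * j + c * τ q j * 7) / 7     ≡⟨ ℕ.+-distrib-/-∣ʳ (c * j * j) (divides (c * τ q j) refl) ⟩
  c * j * j / 7 + c * τ q j * 7 / 7   ≡⟨ cong (_+_ (c * j * j / 7)) (ℕ.m*n/n≡m (c * τ q j) 7) ⟩
  c * j * j / 7 + c * τ q j           ∎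
  where
  open ≡-Reasoning
  expand : ∀ c j q → c * (j + q * 7) * (j + q * 7) ≡ c * j * j + c * (q * (j + j + q * 7)) * 7
  expand = solve-∀

module ClosedForm (α : ℤ) where

  β : ℤ
  β = α -ᶻ + 1

  M : ℤ → ℕ → ℕ → ℤ
  M s a b = s *ᶻ (α ^ᶻ a *ᶻ β ^ᶻ b)

  g : ℕ → ℤ
  g n = M (sign (n % 7)) (E n) (F n)

  -- The factor by which g is multiplied when n moves by a multiple of 7.
  γ : ℤ
  γ = α ^ᶻ 5 *ᶻ β ^ᶻ 3

  M-twist : ∀ s a b t → M s (a + 5 * t) (b + 3 * t) ≡ γ ^ᶻ t *ᶻ M s a b
  M-twist s a b t = begin
    s *ᶻ (α ^ᶻ (a + 5 * t) *ᶻ β ^ᶻ (b + 3 * t))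
      ≡⟨ cong₂ (λ x y → s *ᶻ (x *ᶻ y)) (ℤ.^-distribˡ-+-* α a (5 * t)) (ℤ.^-distribˡ-+-* β b (3 * t)) ⟩
    s *ᶻ (α ^ᶻ a *ᶻ α ^ᶻ (5 * t) *ᶻ (β ^ᶻ b *ᶻ β ^ᶻ (3 * t)))
      ≡⟨ cong₂ (λ x y → s *ᶻ (α ^ᶻ a *ᶻ x *ᶻ (β ^ᶻ b *ᶻ y))) (sym (ℤ.^-*-assoc α 5 t)) (sym (ℤ.^-*-assoc β 3 t)) ⟩
    s *ᶻ (α ^ᶻ a *ᶻ (α ^ᶻ 5) ^ᶻ t *ᶻ (β ^ᶻ b *ᶻ (β ^ᶻ 3) ^ᶻ t))
      ≡⟨ regroup s (α ^ᶻ a) (β ^ᶻ b) ((α ^ᶻ 5) ^ᶻ t) ((β ^ᶻ 3) ^ᶻ t) ⟩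
    (α ^ᶻ 5) ^ᶻ t *ᶻ (β ^ᶻ 3) ^ᶻ t *ᶻ M s a b
      ≡⟨ cong (_*ᶻ M s a b) (sym (^ᶻ-distribʳ-* (α ^ᶻ 5) (β ^ᶻ 3) t)) ⟩
    γ ^ᶻ t *ᶻ M s a b ∎
    where
    open ≡-Reasoning
    regroup : ∀ s A B X Y → s *ᶻ (A *ᶻ X *ᶻ (B *ᶻ Y)) ≡ X *ᶻ Y *ᶻ (s *ᶻ (A *ᶻ B))
    regroup = ℤ-Solver.solve-∀

  g-residue : ∀ j q → g (j + q * 7) ≡ M (sign (j % 7)) (E j + 5 * τ q j) (F j + 3 * τ q j)
  g-residue j q = trans (cong (λ r → M (sign r) (E (j + q * 7)) (F (j + q * 7))) (ℕ.[m+kn]%n≡m%n j q 7))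
                        (cong₂ (M (sign (j % 7))) (quadratic-shift 5 j q) (quadratic-shift 3 j q))

  g-shift : ∀ j q → g (j + q * 7) ≡ γ ^ᶻ τ q j *ᶻ g j
  g-shift j q = trans (g-residue j q) (M-twist (sign (j % 7)) (E j) (F j) (τ q j))

  M-* : ∀ s a b t c d → M s a b *ᶻ M t c d ≡ M (s *ᶻ t) (a + c) (b + d)
  M-* s a b t c d = begin
    s *ᶻ (α ^ᶻ a *ᶻ β ^ᶻ b) *ᶻ (t *ᶻ (α ^ᶻ c *ᶻ β ^ᶻ d))
      ≡⟨ regroup s t (α ^ᶻ a) (β ^ᶻ b) (α ^ᶻ c) (β ^ᶻ d) ⟩
    s *ᶻ t *ᶻ (α ^ᶻ a *ᶻ α ^ᶻ c *ᶻ (β ^ᶻ b *ᶻ β ^ᶻ d))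
      ≡⟨ cong₂ (λ x y → s *ᶻ t *ᶻ (x *ᶻ y)) (sym (ℤ.^-distribˡ-+-* α a c)) (sym (ℤ.^-distribˡ-+-* β b d)) ⟩
    M (s *ᶻ t) (a + c) (b + d) ∎
    where
    open ≡-Reasoning
    regroup : ∀ s t A B C D → s *ᶻ (A *ᶻ B) *ᶻ (t *ᶻ (C *ᶻ D)) ≡ s *ᶻ t *ᶻ (A *ᶻ C *ᶻ (B *ᶻ D))
    regroup = ℤ-Solver.solve-∀

  M-^ : ∀ s a b k → M s a b ^ᶻ k ≡ M (s ^ᶻ k) (a * k) (b * k)
  M-^ s a b zero    rewrite ℕ.*-zeroʳ a | ℕ.*-zeroʳ b = refl
  M-^ s a b (suc k) = begin
    M s a b *ᶻ M s a b ^ᶻ k                    ≡⟨ cong (M s a b *ᶻ_) (M-^ s a b k) ⟩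
    M s a b *ᶻ M (s ^ᶻ k) (a * k) (b * k)      ≡⟨ M-* s a b (s ^ᶻ k) (a * k) (b * k) ⟩
    M (s ^ᶻ suc k) (a + a * k) (b + b * k)     ≡⟨ cong₂ (M (s ^ᶻ suc k)) (sym (ℕ.*-suc a k)) (sym (ℕ.*-suc b k)) ⟩
    M (s ^ᶻ suc k) (a * suc k) (b * suc k)     ∎
    where open ≡-Reasoning

  -- The five ways in which two monomials combine in the base relations; the two
  -- steps use  α - β = 1.
  M-cancel : ∀ s a b c d → M s a b -ᶻ M s a b ≡ M (+ 0) c d
  M-cancel s a b c d = ℤ.+-inverseʳ (M s a b)

  M-dropʳ : ∀ s a b c d → M s a b -ᶻ M (+ 0) c d ≡ M s a b
  M-dropʳ s a b c d = ℤ.+-identityʳ (M s a b)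

  M-dropˡ : ∀ s a b c d → M (+ 0) c d -ᶻ M s a b ≡ M (-ᶻ s) a b
  M-dropˡ s a b c d = trans (ℤ.+-identityˡ _) (ℤ.neg-distribˡ-* s (α ^ᶻ a *ᶻ β ^ᶻ b))

  M-stepα : ∀ s a b → M s a b -ᶻ M s (suc a) b ≡ M (-ᶻ s) a (suc b)
  M-stepα s a b = step s α (α ^ᶻ a) (β ^ᶻ b)
    where
    step : ∀ s α A B → s *ᶻ (A *ᶻ B) -ᶻ s *ᶻ (α *ᶻ A *ᶻ B) ≡ -ᶻ s *ᶻ (A *ᶻ ((α -ᶻ + 1) *ᶻ B))
    step = ℤ-Solver.solve-∀

  M-stepβ : ∀ s a b → M s (suc a) b -ᶻ M s a b ≡ M s a (suc b)
  M-stepβ s a b = step s α (α ^ᶻ a) (β ^ᶻ b)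
    where
    step : ∀ s α A B → s *ᶻ (α *ᶻ A *ᶻ B) -ᶻ s *ᶻ (A *ᶻ B) ≡ s *ᶻ (A *ᶻ ((α -ᶻ + 1) *ᶻ B))
    step = ℤ-Solver.solve-∀

  -- The two recurrences, with the division by u₂ cleared in the even one.
  OddRelation : (ℕ → ℤ) → ℕ → Set
  OddRelation u m = odd-step u m ≡ u (suc (m * 2))

  EvenRelation : (ℕ → ℤ) → ℕ → Set
  EvenRelation u m = even-step u m ≡ u (m * 2) *ᶻ u 2

  mono₃ : ℕ → ℕ → ℤ
  mono₃ m n = M (sign (m % 7) *ᶻ sign (n % 7) ^ᶻ 3) (E m + E n * 3) (F m + F n * 3)

  mono₂ : ℕ → ℕ → ℕ → ℤ
  mono₂ l m n = M (sign (l % 7) *ᶻ (sign (m % 7) *ᶻ sign (n % 7) ^ᶻ 2)) (E l + (E m + E n * 2)) (F l + (F m + F n * 2))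

  mono₁ : ℕ → ℕ → ℤ
  mono₁ m n = M (sign (m % 7) *ᶻ sign (n % 7)) (E m + E n) (F m + F n)

  odd-monomial : ∀ m n → g m *ᶻ g n ^ᶻ 3 ≡ mono₃ m n
  odd-monomial m n = trans (cong (g m *ᶻ_) (M-^ (sign (n % 7)) (E n) (F n) 3))
    (M-* (sign (m % 7)) (E m) (F m) (sign (n % 7) ^ᶻ 3) (E n * 3) (F n * 3))

  even-monomial : ∀ l m n → g l *ᶻ (g m *ᶻ g n ^ᶻ 2) ≡ mono₂ l m n
  even-monomial l m n = begin
    g l *ᶻ (g m *ᶻ g n ^ᶻ 2)
      ≡⟨ cong (λ x → g l *ᶻ (g m *ᶻ x)) (M-^ (sign (n % 7)) (E n) (F n) 2) ⟩
    g l *ᶻ (g m *ᶻ M (sign (n % 7) ^ᶻ 2) (E n * 2) (F n * 2))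
      ≡⟨ cong (g l *ᶻ_) (M-* (sign (m % 7)) (E m) (F m) (sign (n % 7) ^ᶻ 2) (E n * 2) (F n * 2)) ⟩
    g l *ᶻ M (sign (m % 7) *ᶻ sign (n % 7) ^ᶻ 2) (E m + E n * 2) (F m + F n * 2)
      ≡⟨ M-* (sign (l % 7)) (E l) (F l) (sign (m % 7) *ᶻ sign (n % 7) ^ᶻ 2) (E m + E n * 2) (F m + F n * 2) ⟩
    mono₂ l m n ∎
    where open ≡-Reasoning

  odd-base : ∀ m → mono₃ (m + 2) m -ᶻ mono₃ (m ∸ 1) (m + 1) ≡ g (suc (m * 2)) → OddRelation g m
  odd-base m = trans (cong₂ _-ᶻ_ (odd-monomial (m + 2) m) (odd-monomial (m ∸ 1) (m + 1)))

  even-base : ∀ m → mono₂ m (m + 2) (m ∸ 1) -ᶻ mono₂ m (m ∸ 2) (m + 1) ≡ mono₁ (m * 2) 2 → EvenRelation g m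
  even-base m combine = begin
    g m *ᶻ (g (m + 2) *ᶻ g (m ∸ 1) ^ᶻ 2 -ᶻ g (m ∸ 2) *ᶻ g (m + 1) ^ᶻ 2)
      ≡⟨ distrib (g m) _ _ ⟩
    g m *ᶻ (g (m + 2) *ᶻ g (m ∸ 1) ^ᶻ 2) -ᶻ g m *ᶻ (g (m ∸ 2) *ᶻ g (m + 1) ^ᶻ 2)
      ≡⟨ cong₂ _-ᶻ_ (even-monomial m (m + 2) (m ∸ 1)) (even-monomial m (m ∸ 2) (m + 1)) ⟩
    mono₂ m (m + 2) (m ∸ 1) -ᶻ mono₂ m (m ∸ 2) (m + 1)
      ≡⟨ combine ⟩
    mono₁ (m * 2) 2
      ≡⟨ sym (M-* (sign ((m * 2) % 7)) (E (m * 2)) (F (m * 2)) (sign 2) (E 2) (F 2)) ⟩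
    g (m * 2) *ᶻ g 2 ∎
    where
    open ≡-Reasoning
    distrib : ∀ x y z → x *ᶻ (y -ᶻ z) ≡ x *ᶻ y -ᶻ x *ᶻ z
    distrib = ℤ-Solver.solve-∀

  -- The recurrences for the seven smallest indices, one per residue mod 7; the
  -- exponents are those computed from  E n = ⌊5n²/7⌋,  F n = ⌊3n²/7⌋.
  odd-residue : ∀ j → j < 7 → OddRelation g (suc j)
  odd-residue 0 _ = odd-base 1 (M-dropʳ -1ℤ 6 3 6 3)
  odd-residue 1 _ = odd-base 2 (M-stepα -1ℤ 17 9)
  odd-residue 2 _ = odd-base 3 (M-cancel -1ℤ 35 19 35 21)
  odd-residue 3 _ = odd-base 4 (M-stepβ -1ℤ 57 33)
  odd-residue 4 _ = odd-base 5 (M-dropˡ -1ℤ 86 51 86 51)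
  odd-residue 5 _ = odd-base 6 (M-dropʳ -1ℤ 120 72 122 73)
  odd-residue 6 _ = odd-base 7 (M-dropˡ -1ℤ 160 96 162 97)
  odd-residue (suc (suc (suc (suc (suc (suc (suc _))))))) (s≤s (s≤s (s≤s (s≤s (s≤s (s≤s (s≤s ())))))))

  even-residue : ∀ j → j < 7 → EvenRelation g (suc (suc j))
  even-residue 0 _ = even-base 2 (M-dropʳ -1ℤ 13 7 14 7)
  even-residue 1 _ = even-base 3 (M-stepα -1ℤ 27 15)
  even-residue 2 _ = even-base 4 (M-stepβ -1ℤ 47 27)
  even-residue 3 _ = even-base 5 (M-dropˡ -1ℤ 73 43 74 43)
  even-residue 4 _ = even-base 6 (M-dropʳ -1ℤ 104 62 106 63)
  even-residue 5 _ = even-base 7 (M-cancel (+ 0) 142 85 142 85)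
  even-residue 6 _ = even-base 8 (M-dropˡ -1ℤ 184 110 186 111)
  even-residue (suc (suc (suc (suc (suc (suc (suc _))))))) (s≤s (s≤s (s≤s (s≤s (s≤s (s≤s (s≤s ())))))))

  open Homogeneity γ

  g-at : ∀ {n} j q → n ≡ j + q * 7 → g n ≡ γ ^ᶻ τ q j *ᶻ g j
  g-at j q refl = g-shift j q

  -- The recurrences at index m = 1 + j + 7q (resp. 2 + j + 7q) are those at
  -- m = 1 + j (resp. 2 + j), scaled by powers of γ whose weights balance.
  odd-relation : ∀ m → 1 ≤ m → OddRelation g m
  odd-relation (suc k) _ =
    subst (OddRelation g ∘ suc) (sym (ℕ.m≡m%n+[m/n]*n k 7)) (odd-at (k % 7) (k / 7) (ℕ.m%n<n k 7))
    where
    odd-at : ∀ j q → j < 7 → OddRelation g (suc (j + q * 7))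
    odd-at j q j<7 = odd-homogeneous
      (τ q (suc j + 2)) (τ q (suc j)) (τ q j) (τ q (suc j + 1)) (τ (q + q) (suc (suc j * 2)))
      (g (suc j + 2)) (g (suc j)) (g j) (g (suc j + 1)) (g (suc (suc j * 2)))
      (w₁ j q) (w₂ j q)
      (g-at (suc j + 2) q (i₁ j q)) (g-at (suc j) q refl) (g-at j q refl) (g-at (suc j + 1) q (i₂ j q))
      (g-at (suc (suc j * 2)) (q + q) (i₃ j q)) (odd-residue j j<7)
      where
      -- the weights (τ unfolded, as the solver does not unfold definitions) and indices
      w₁ : ∀ a b → b * (suc a + 2 + (suc a + 2) + b * 7) + b * (suc a + suc a + b * 7) * 3
                 ≡ (b + b) * (suc (suc a * 2) + suc (suc a * 2) + (b + b) * 7)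
      w₁ = solve-∀
      w₂ : ∀ a b → b * (a + a + b * 7) + b * (suc a + 1 + (suc a + 1) + b * 7) * 3
                 ≡ (b + b) * (suc (suc a * 2) + suc (suc a * 2) + (b + b) * 7)
      w₂ = solve-∀
      i₁ : ∀ a b → suc (a + b * 7) + 2 ≡ suc a + 2 + b * 7
      i₁ = solve-∀
      i₂ : ∀ a b → suc (a + b * 7) + 1 ≡ suc a + 1 + b * 7
      i₂ = solve-∀
      i₃ : ∀ a b → suc (suc (a + b * 7) * 2) ≡ suc (suc a * 2) + (b + b) * 7
      i₃ = solve-∀

  even-relation : ∀ m → 2 ≤ m → EvenRelation g m
  even-relation (suc zero) (s≤s ())
  even-relation (suc (suc k)) _ =
    subst (EvenRelation g ∘ suc ∘ suc) (sym (ℕ.m≡m%n+[m/n]*n k 7)) (even-at (k % 7) (k / 7) (ℕ.m%n<n k 7))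
    where
    even-at : ∀ j q → j < 7 → EvenRelation g (suc (suc (j + q * 7)))
    even-at j q j<7 = even-homogeneous
      (τ q (suc (suc j))) (τ q (suc (suc j) + 2)) (τ q (suc j)) (τ q j) (τ q (suc (suc j) + 1)) (τ (q + q) (suc (suc j) * 2))
      (g (suc (suc j))) (g (suc (suc j) + 2)) (g (suc j)) (g j) (g (suc (suc j) + 1)) (g (suc (suc j) * 2)) (g 2)
      (w₁ j q) (w₂ j q)
      (g-at (suc (suc j)) q refl) (g-at (suc (suc j) + 2) q (i₁ j q)) (g-at (suc j) q refl) (g-at j q refl)
      (g-at (suc (suc j) + 1) q (i₂ j q)) (g-at (suc (suc j) * 2) (q + q) (i₃ j q)) (even-residue j j<7)
      where
      w₁ : ∀ a b → b * (suc (suc a) + suc (suc a) + b * 7)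
                   + (b * (suc (suc a) + 2 + (suc (suc a) + 2) + b * 7) + b * (suc a + suc a + b * 7) * 2)
                 ≡ (b + b) * (suc (suc a) * 2 + suc (suc a) * 2 + (b + b) * 7)
      w₁ = solve-∀
      w₂ : ∀ a b → b * (suc (suc a) + suc (suc a) + b * 7)
                   + (b * (a + a + b * 7) + b * (suc (suc a) + 1 + (suc (suc a) + 1) + b * 7) * 2)
                 ≡ (b + b) * (suc (suc a) * 2 + suc (suc a) * 2 + (b + b) * 7)
      w₂ = solve-∀
      i₁ : ∀ a b → suc (suc (a + b * 7)) + 2 ≡ suc (suc a) + 2 + b * 7
      i₁ = solve-∀
      i₂ : ∀ a b → suc (suc (a + b * 7)) + 1 ≡ suc (suc a) + 1 + b * 7
      i₂ = solve-∀
      i₃ : ∀ a b → suc (suc (a + b * 7)) * 2 ≡ suc (suc a) * 2 + (b + b) * 7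
      i₃ = solve-∀

-- For α ∉ {0, 1} the closed form g is the sequence h of the definition: by strong
-- induction on n, as the two recurrences hold for g and h₂ = g 2 ≠ 0.
module Agreement (α : ℤ) (α≢0 : ¬ α ≡ + 0) (α≢1 : ¬ α ≡ + 1) where
  open ClosedForm α
  open ≡-Reasoning

  double : ∀ m → m + m ≡ m * 2
  double = solve-∀

  β≢0 : ¬ β ≡ + 0
  β≢0 β≡0 = α≢1 (ℤ.i-j≡0⇒i≡j α (+ 1) β≡0)

  M≢0 : ∀ s a b → ¬ s ≡ + 0 → ¬ M s a b ≡ + 0
  M≢0 s a b s≢0 M≡0 with ℤ.i*j≡0⇒i≡0∨j≡0 s M≡0
  ... | inj₁ s≡0 = s≢0 s≡0
  ... | inj₂ p with ℤ.i*j≡0⇒i≡0∨j≡0 (α ^ᶻ a) p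
  ...   | inj₁ q = α≢0 (ℤ.i^n≡0⇒i≡0 α a q)
  ...   | inj₂ q = β≢0 (ℤ.i^n≡0⇒i≡0 β b q)

  g₂≢0 : ¬ g 2 ≡ + 0
  g₂≢0 = M≢0 -1ℤ 2 1 (λ ())

  -- In both cases the middle index m of n ∈ {2m, 2m+1} satisfies m + 2 < n, as n ≥ 5.
  odd-case : ∀ (u : ℕ → ℤ) k m → 5 + k ≡ suc (m * 2) → (∀ i → i < 5 + k → u i ≡ g i) →
    odd-step u m ≡ g (5 + k)
  odd-case u k m@(suc (suc _)) n≡2m+1 agree = begin
    odd-step u m       ≡⟨ proj₁ (step-local u g m (λ i i≤m+2 → agree i (ℕ.≤-<-trans i≤m+2 m+2<n))) ⟩
    odd-step g m       ≡⟨ odd-relation m (s≤s z≤n) ⟩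
    g (suc (m * 2))    ≡⟨ cong g (sym n≡2m+1) ⟩
    g (5 + k)          ∎
    where
    m+2<n : m + 2 < 5 + k
    m+2<n = subst (m + 2 <_) (sym n≡2m+1) (s≤s (subst (m + 2 ≤_) (double m) (ℕ.+-monoʳ-≤ m (s≤s (s≤s z≤n)))))

  even-case : ∀ (u : ℕ → ℤ) k m → 5 + k ≡ m * 2 → (∀ i → i < 5 + k → u i ≡ g i) →
    even-step u m ÷ u 2 ≡ g (5 + k)
  even-case u k m@(suc (suc (suc _))) n≡2m agree = begin
    even-step u m ÷ u 2            ≡⟨ cong₂ _÷_ (proj₂ (step-local u g m (λ i i≤m+2 → agree i (ℕ.≤-<-trans i≤m+2 m+2<n))))
                                                 (agree 2 (s≤s (s≤s (s≤s z≤n)))) ⟩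
    even-step g m ÷ g 2            ≡⟨ cong (_÷ g 2) (even-relation m (s≤s (s≤s z≤n))) ⟩
    (g (m * 2) *ᶻ g 2) ÷ g 2       ≡⟨ ÷-exact (g (m * 2)) (g 2) g₂≢0 ⟩
    g (m * 2)                      ≡⟨ cong g (sym n≡2m) ⟩
    g (5 + k)                      ∎
    where
    m+2<n : m + 2 < 5 + k
    m+2<n = subst (m + 2 <_) (trans (double m) (sym n≡2m)) (ℕ.+-monoʳ-< m (s≤s (s≤s (s≤s z≤n))))

  hF-large : ∀ f k → (∀ i → i < 5 + k → hF α f i ≡ g i) → hF α (suc f) (5 + k) ≡ g (5 + k)
  hF-large f k below with (5 + k) % 2 in parity
  ... | zero  = even-case (hF α f) k n/2 (trans (ℕ.m≡m%n+[m/n]*n (5 + k) 2) (cong (_+ n/2 * 2) parity)) below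
    where n/2 = (5 + k) / 2
  ... | suc r = odd-case (hF α f) k n/2 (trans (ℕ.m≡m%n+[m/n]*n (5 + k) 2) (cong (_+ n/2 * 2) odd)) below
    where
    n/2 = (5 + k) / 2
    odd : (5 + k) % 2 ≡ 1
    odd with subst (_< 2) parity (ℕ.m%n<n (5 + k) 2)
    ... | s≤s (s≤s z≤n) = parity

  hF-agrees : ∀ f n → n < f → hF α f n ≡ g n
  hF-agrees (suc f) 0 _ = refl
  hF-agrees (suc f) 1 _ = refl
  hF-agrees (suc f) 2 _ = sym (trans (ℤ.-1*i≡-i _) (cong (λ x → -ᶻ (α ^ᶻ 2 *ᶻ x)) (ℤ.*-identityʳ β)))
  hF-agrees (suc f) 3 _ = sym (ℤ.-1*i≡-i _)
  hF-agrees (suc f) 4 _ = sym (ℤ.*-identityˡ _)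
  hF-agrees (suc f) (suc (suc (suc (suc (suc k))))) (s≤s n≤f) =
    hF-large f k (λ i i<n → hF-agrees f i (ℕ.<-≤-trans i<n n≤f))

  h≡g : ∀ n → h α n ≡ g n
  h≡g n = hF-agrees (suc n) n ℕ.≤-refl

module PowerFree (α : ℤ) (α≢0 : ¬ α ≡ + 0) (α≢1 : ¬ α ≡ + 1) where
  open ClosedForm α
  open Agreement α α≢0 α≢1
  open ≡-Reasoning

  abs-M : ∀ s a b → ∣ s ∣ ≡ 1 → ∣ M s a b ∣ ≡ ∣ α ∣ ^ a * ∣ β ∣ ^ b
  abs-M s a b ∣s∣≡1 = begin
    ∣ s *ᶻ (α ^ᶻ a *ᶻ β ^ᶻ b) ∣          ≡⟨ ℤ.abs-* s _ ⟩
    ∣ s ∣ * ∣ α ^ᶻ a *ᶻ β ^ᶻ b ∣         ≡⟨ cong (_* ∣ α ^ᶻ a *ᶻ β ^ᶻ b ∣) ∣s∣≡1 ⟩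
    1 * ∣ α ^ᶻ a *ᶻ β ^ᶻ b ∣             ≡⟨ ℕ.*-identityˡ _ ⟩
    ∣ α ^ᶻ a *ᶻ β ^ᶻ b ∣                 ≡⟨ ℤ.abs-* (α ^ᶻ a) (β ^ᶻ b) ⟩
    ∣ α ^ᶻ a ∣ * ∣ β ^ᶻ b ∣              ≡⟨ cong₂ _*_ (abs-^ α a) (abs-^ β b) ⟩
    ∣ α ∣ ^ a * ∣ β ∣ ^ b                ∎

  ∣α∣≢0 : ¬ ∣ α ∣ ≡ 0
  ∣α∣≢0 = α≢0 ∘ ℤ.∣i∣≡0⇒i≡0

  ∣β∣≢0 : ¬ ∣ β ∣ ≡ 0
  ∣β∣≢0 = β≢0 ∘ ℤ.∣i∣≡0⇒i≡0

  no-square : ∀ δ → ¬ ∣ α ∣ ^ 1 * ∣ β ∣ ^ 1 ≡ δ ^ 2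
  no-square δ with consecutive α α≢0 α≢1
  ... | x , x≢0 , inj₁ (∣α∣≡x , ∣β∣≡1+x) rewrite ∣α∣≡x | ∣β∣≡1+x =
    mixed-not-power x 1 1 {{x≢0}} δ
  ... | x , x≢0 , inj₂ (∣α∣≡1+x , ∣β∣≡x) rewrite ∣α∣≡1+x | ∣β∣≡x =
    mixed-not-power x 1 1 {{x≢0}} δ ∘ trans (ℕ.*-comm (x ^ 1) (suc x ^ 1))

  no-cube : ∀ δ → ¬ ∣ α ∣ ^ 2 * ∣ β ∣ ^ 1 ≡ δ ^ 3
  no-cube δ with consecutive α α≢0 α≢1
  ... | x , x≢0 , inj₁ (∣α∣≡x , ∣β∣≡1+x) rewrite ∣α∣≡x | ∣β∣≡1+x =
    mixed-not-power x 2 1 {{x≢0}} δ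
  ... | x , x≢0 , inj₂ (∣α∣≡1+x , ∣β∣≡x) rewrite ∣α∣≡1+x | ∣β∣≡x =
    mixed-not-power x 1 2 {{x≢0}} δ ∘ trans (ℕ.*-comm (x ^ 1) (suc x ^ 2))

  not-square : ∀ s a b → ∣ s ∣ ≡ 1 → ¬ IsSquare (M s (1 + a * 2) (1 + b * 2))
  not-square s a b ∣s∣≡1 (c , _ , M≡±c²) = uncurry no-square
    (power-cofactor₂ 2 (∣ α ∣) (∣ β ∣) 1 1 a b (∣ c ∣) ∣α∣≢0 ∣β∣≢0
      (trans (sym (abs-M s (1 + a * 2) (1 + b * 2) ∣s∣≡1)) (abs-±square M≡±c²)))
    where
    abs-±square : ∀ {x} → x ≡ c *ᶻ c ⊎ x ≡ -ᶻ (c *ᶻ c) → ∣ x ∣ ≡ ∣ c ∣ ^ 2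
    abs-±square (inj₁ refl) = trans (ℤ.abs-* c c) (cong (∣ c ∣ *_) (sym (ℕ.*-identityʳ ∣ c ∣)))
    abs-±square (inj₂ refl) = trans (ℤ.∣-i∣≡∣i∣ (c *ᶻ c)) (abs-±square (inj₁ refl))

  not-cube : ∀ s a b → ∣ s ∣ ≡ 1 → ¬ IsCube (M s (2 + a * 3) (1 + b * 3))
  not-cube s a b ∣s∣≡1 (c , _ , M≡c³) = uncurry no-cube
    (power-cofactor₂ 3 (∣ α ∣) (∣ β ∣) 2 1 a b (∣ c ∣) ∣α∣≢0 ∣β∣≢0
      (trans (sym (abs-M s (2 + a * 3) (1 + b * 3) ∣s∣≡1)) abs-cube))
    where
    abs-cube : ∣ M s (2 + a * 3) (1 + b * 3) ∣ ≡ ∣ c ∣ ^ 3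
    abs-cube = begin
      ∣ M s (2 + a * 3) (1 + b * 3) ∣   ≡⟨ cong ∣_∣ M≡c³ ⟩
      ∣ c *ᶻ c *ᶻ c ∣                   ≡⟨ ℤ.abs-* (c *ᶻ c) c ⟩
      ∣ c *ᶻ c ∣ * ∣ c ∣                ≡⟨ cong (_* ∣ c ∣) (ℤ.abs-* c c) ⟩
      ∣ c ∣ * ∣ c ∣ * ∣ c ∣             ≡⟨ cube ∣ c ∣ ⟩
      ∣ c ∣ ^ 3                         ∎
      where
      cube : ∀ x → x * x * x ≡ x * (x * (x * 1))
      cube = solve-∀

  h-residue : ∀ {n} j q → n ≡ j + q * 7 → h α n ≡ M (sign (j % 7)) (E j + 5 * τ q j) (F j + 3 * τ q j)
  h-residue {n} j q refl = trans (h≡g n) (g-residue j q)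

  square-class : ∀ {n} j q a b → n ≡ j + q * 7 → ∣ sign (j % 7) ∣ ≡ 1 →
    E j + 5 * τ q j ≡ 1 + a * 2 → F j + 3 * τ q j ≡ 1 + b * 2 → ¬ IsSquare (h α n)
  square-class j q a b n≡ ∣s∣≡1 eE eF = not-square (sign (j % 7)) a b ∣s∣≡1
    ∘ subst IsSquare (trans (h-residue j q n≡) (cong₂ (M (sign (j % 7))) eE eF))

  cube-class : ∀ {n} j q a b → n ≡ j + q * 7 → ∣ sign (j % 7) ∣ ≡ 1 →
    E j + 5 * τ q j ≡ 2 + a * 3 → F j + 3 * τ q j ≡ 1 + b * 3 → ¬ IsCube (h α n)
  cube-class j q a b n≡ ∣s∣≡1 eE eF = not-cube (sign (j % 7)) a b ∣s∣≡1
    ∘ subst IsCube (trans (h-residue j q n≡) (cong₂ (M (sign (j % 7))) eE eF))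

  -- In each, n = j + 7q, and the exponents
  -- E j + 5τ and F j + 3τ are written out (with τ = τ(q, j) unfolded).
  -- n = 6 + 14t = 6 + 7·2t:  exponents 25 + 10σ and 15 + 6σ, σ = t(12 + 14t), both odd.
  square-6 : ∀ t → ¬ IsSquare (h α (6 + t * 14))
  square-6 t = square-class 6 (t + t) (12 + 5 * σ) (7 + 3 * σ) (index t) refl (eE t) (eF t)
    where
    σ = t * (12 + t * 14)
    index : ∀ t → 6 + t * 14 ≡ 6 + (t + t) * 7
    index = solve-∀
    eE : ∀ t → 25 + 5 * ((t + t) * (12 + (t + t) * 7)) ≡ 1 + (12 + 5 * (t * (12 + t * 14))) * 2
    eE = solve-∀
    eF : ∀ t → 15 + 3 * ((t + t) * (12 + (t + t) * 7)) ≡ 1 + (7 + 3 * (t * (12 + t * 14))) * 2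
    eF = solve-∀

  -- n = 8 + 14t = 1 + 7(1 + 2t):  exponents 5τ and 3τ with τ = 1 + 2ρ, ρ = 4 + t(16 + 14t).
  square-8 : ∀ t → ¬ IsSquare (h α (8 + t * 14))
  square-8 t = square-class 1 (1 + (t + t)) (2 + 5 * ρ) (1 + 3 * ρ) (index t) refl (eE t) (eF t)
    where
    ρ = 4 + t * (16 + t * 14)
    index : ∀ t → 8 + t * 14 ≡ 1 + (1 + (t + t)) * 7
    index = solve-∀
    eE : ∀ t → 0 + 5 * ((1 + (t + t)) * (2 + (1 + (t + t)) * 7)) ≡ 1 + (2 + 5 * (4 + t * (16 + t * 14))) * 2
    eE = solve-∀
    eF : ∀ t → 0 + 3 * ((1 + (t + t)) * (2 + (1 + (t + t)) * 7)) ≡ 1 + (1 + 3 * (4 + t * (16 + t * 14))) * 2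
    eF = solve-∀

  -- n = 2 + 21t = 2 + 7·3t:  exponents 2 + 15σ and 1 + 9σ, σ = t(4 + 21t).
  cube-2 : ∀ t → ¬ IsCube (h α (2 + t * 21))
  cube-2 t = cube-class 2 (t * 3) (5 * σ) (3 * σ) (index t) refl (eE t) (eF t)
    where
    σ = t * (4 + t * 21)
    index : ∀ t → 2 + t * 21 ≡ 2 + t * 3 * 7
    index = solve-∀
    eE : ∀ t → 2 + 5 * (t * 3 * (4 + t * 3 * 7)) ≡ 2 + 5 * (t * (4 + t * 21)) * 3
    eE = solve-∀
    eF : ∀ t → 1 + 3 * (t * 3 * (4 + t * 3 * 7)) ≡ 1 + 3 * (t * (4 + t * 21)) * 3
    eF = solve-∀

  -- n = 5 + 21t = 5 + 7·3t:  exponents 17 + 15σ and 10 + 9σ, σ = t(10 + 21t).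
  cube-5 : ∀ t → ¬ IsCube (h α (5 + t * 21))
  cube-5 t = cube-class 5 (t * 3) (5 + 5 * σ) (3 + 3 * σ) (index t) refl (eE t) (eF t)
    where
    σ = t * (10 + t * 21)
    index : ∀ t → 5 + t * 21 ≡ 5 + t * 3 * 7
    index = solve-∀
    eE : ∀ t → 17 + 5 * (t * 3 * (10 + t * 3 * 7)) ≡ 2 + (5 + 5 * (t * (10 + t * 21))) * 3
    eE = solve-∀
    eF : ∀ t → 10 + 3 * (t * 3 * (10 + t * 3 * 7)) ≡ 1 + (3 + 3 * (t * (10 + t * 21))) * 3
    eF = solve-∀

  -- n = 16 + 21t = 2 + 7(2 + 3t):  exponents 2 + 15σ and 1 + 9σ, σ = (2 + 3t)(6 + 7t).
  cube-16 : ∀ t → ¬ IsCube (h α (16 + t * 21))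
  cube-16 t = cube-class 2 (2 + t * 3) (5 * σ) (3 * σ) (index t) refl (eE t) (eF t)
    where
    σ = (2 + t * 3) * (6 + t * 7)
    index : ∀ t → 16 + t * 21 ≡ 2 + (2 + t * 3) * 7
    index = solve-∀
    eE : ∀ t → 2 + 5 * ((2 + t * 3) * (4 + (2 + t * 3) * 7)) ≡ 2 + 5 * ((2 + t * 3) * (6 + t * 7)) * 3
    eE = solve-∀
    eF : ∀ t → 1 + 3 * ((2 + t * 3) * (4 + (2 + t * 3) * 7)) ≡ 1 + 3 * ((2 + t * 3) * (6 + t * 7)) * 3
    eF = solve-∀

  -- n = 19 + 21t = 5 + 7(2 + 3t):  exponents 17 + 15σ and 10 + 9σ, σ = (2 + 3t)(8 + 7t).
  cube-19 : ∀ t → ¬ IsCube (h α (19 + t * 21))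
  cube-19 t = cube-class 5 (2 + t * 3) (5 + 5 * σ) (3 + 3 * σ) (index t) refl (eE t) (eF t)
    where
    σ = (2 + t * 3) * (8 + t * 7)
    index : ∀ t → 19 + t * 21 ≡ 5 + (2 + t * 3) * 7
    index = solve-∀
    eE : ∀ t → 17 + 5 * ((2 + t * 3) * (10 + (2 + t * 3) * 7)) ≡ 2 + (5 + 5 * ((2 + t * 3) * (8 + t * 7))) * 3
    eE = solve-∀
    eF : ∀ t → 10 + 3 * ((2 + t * 3) * (10 + (2 + t * 3) * 7)) ≡ 1 + (3 + 3 * ((2 + t * 3) * (8 + t * 7))) * 3
    eF = solve-∀

on-residue-class : ∀ (P : ℕ → Set) d .{{_ : NonZero d}} r → (∀ t → P (r + t * d)) → ∀ n → n % d ≡ r → P n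
on-residue-class P d r P-class n n%d≡r =
  subst P (sym (trans (ℕ.m≡m%n+[m/n]*n n d) (cong (_+ n / d * d) n%d≡r))) (P-class (n / d))

theorem5p10 : (α : ℤ) → ¬ (α ≡ + 0) → ¬ (α ≡ + 1) →
    ((n : ℕ) → (n % 14 ≡ 6 ⊎ n % 14 ≡ 8) → ¬ IsSquare (h α n))
    × ((n : ℕ) → (n % 21 ≡ 2 ⊎ n % 21 ≡ 5 ⊎ n % 21 ≡ 16 ⊎ n % 21 ≡ 19) → ¬ IsCube (h α n))
theorem5p10 α α≢0 α≢1 = squares , cubes
  where
  open PowerFree α α≢0 α≢1
  squares : (n : ℕ) → (n % 14 ≡ 6 ⊎ n % 14 ≡ 8) → ¬ IsSquare (h α n)
  squares n (inj₁ r) = on-residue-class (λ n → ¬ IsSquare (h α n)) 14 6 square-6 n r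
  squares n (inj₂ r) = on-residue-class (λ n → ¬ IsSquare (h α n)) 14 8 square-8 n r
  cubes : (n : ℕ) → (n % 21 ≡ 2 ⊎ n % 21 ≡ 5 ⊎ n % 21 ≡ 16 ⊎ n % 21 ≡ 19) → ¬ IsCube (h α n)
  cubes n (inj₁ r)               = on-residue-class (λ n → ¬ IsCube (h α n)) 21 2 cube-2 n r
  cubes n (inj₂ (inj₁ r))        = on-residue-class (λ n → ¬ IsCube (h α n)) 21 5 cube-5 n r
  cubes n (inj₂ (inj₂ (inj₁ r))) = on-residue-class (λ n → ¬ IsCube (h α n)) 21 16 cube-16 n r
  cubes n (inj₂ (inj₂ (inj₂ r))) = on-residue-class (λ n → ¬ IsCube (h α n)) 21 19 cube-19 n r
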